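{- For all finite sets $\Gamma_1,\Gamma_2$ of formulas and finite multisets $\Delta_1,\Delta_2$ of formulas: $(\Gamma_1;\Delta_1)\preceq_l(\Gamma_2;\Delta_2)$ if and only if $(\Gamma_1;\Delta_1)\preceq_c(\Gamma_2;\Delta_2)$.
   Context: Formulas: $A,B,C ::= a \mid \mathbf{1} \mid A\otimes B \mid \top \mid A \,\&\, B \mid a \multimap B \mid\ !A$, with $a$ ranging over atomic formulas. Contexts $\Gamma,\Delta$ are finite multisets of formulas; "$\Delta_1,\Delta_2$" is multiset union, "$\cdot$" the empty context. Sequents $\Gamma;\Delta\vdash A$ are derivable by the rules: (init) $\Gamma;a\vdash a$. (clone) from $\Gamma,A;\Delta,A\vdash C$ infer $\Gamma,A;\Delta\vdash C$. ($\otimes$R) from $\Gamma;\Delta_1\vdash A$ and $\Gamma;\Delta_2\vdash B$ infer $\Gamma;\Delta_1,\Delta_2\vdash A\otimes B$. ($\otimes$L) from $\Gamma;\Delta,A,B\vdash C$ infer $\Gamma;\Delta,A\otimes B\vdash C$. ($\mathbf 1$R) $\Gamma;\cdot\vdash\mathbf 1$. ($\mathbf 1$L) from $\Gamma;\Delta\vdash C$ infer $\Gamma;\Delta,\mathbf 1\vdash C$. ($\&$R) from $\Gamma;\Delta\vdash A$ and $\Gamma;\Delta\vdash B$ infer $\Gamma;\Delta\vdash A\&B$. ($\&$L$_i$, $i=1,2$) from $\Gamma;\Delta,A_i\vdash C$ infer $\Gamma;\Delta,A_1\&A_2\vdash C$. ($\top$R) $\Gamma;\Delta\vdash\top$ (no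 left rule for $\top$). ($\multimap$R) from $\Gamma;\Delta,a\vdash B$ infer $\Gamma;\Delta\vdash a\multimap B$. ($\multimap$L) from $\Gamma;\Delta_1\vdash a$ and $\Gamma;\Delta_2,B\vdash C$ infer $\Gamma;\Delta_1,\Delta_2,a\multimap B\vdash C$. (!R) from $\Gamma;\cdot\vdash A$ infer $\Gamma;\cdot\vdash\,!A$. (!L) from $\Gamma,A;\Delta\vdash C$ infer $\Gamma;\Delta,!A\vdash C$. Logical preorder: $(\Gamma_1;\Delta_1)\preceq_l(\Gamma_2;\Delta_2)$ iff for all contexts $\Gamma',\Delta'$ and all formulas $C$, derivability of $\Gamma',\Gamma_1;\Delta',\Delta_1\vdash C$ implies derivability of $\Gamma',\Gamma_2;\Delta',\Delta_2\vdash C$. States (processes) are pairs $(\Gamma;\Delta)$ modulo structural congruence $\equiv$: $\Delta$ is a multiset and $\Gamma$ a set ($(\Gamma,A,A;\Delta)\equiv(\Gamma,A;\Delta)$); congruent states are identified. Composition: $((\Gamma_1;\Delta_1),(\Gamma_2;\Delta_2)) := (\Gamma_1,\Gamma_2;\Delta_1,\Delta_2)$. The reduction relation $\rightsquigarrow$ on states is given by: $(\Gamma;\Delta,A\otimes B)\rightsquigarrow(\Gamma;\Delta,A,B)$; $(\Gamma;\Delta,\mathbf 1)\rightsquigarrow(\Gamma;\Delta)$; $(\Gamma;\Delta,A_1\&A_2)\rightsquigarrow(\Gamma;\Delta,A_i)$ for $i=1,2$; $(\Gamma;\Delta,a,a\multimap B)\rightsquigarrow(\Gamma;\Delta,B)$;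 $(\Gamma;\Delta,!A)\rightsquigarrow(\Gamma,A;\Delta)$; $(\Gamma,A;\Delta)\rightsquigarrow(\Gamma,A;\Delta,A)$ (no rule for $\top$). $\rightsquigarrow^*$ is its reflexive transitive closure. Write $(\Gamma;\Delta)\downarrow_a$ if $a\in\Delta$, and $(\Gamma;\Delta)\Downarrow_a$ if $(\Gamma;\Delta)\rightsquigarrow^*(\Gamma';\Delta')$ for some $(\Gamma';\Delta')$ with $(\Gamma';\Delta')\downarrow_a$. A binary relation $\mathcal R$ on states is: barb-preserving if $S_1\mathcal R S_2$ and $S_1\downarrow_a$ imply $S_2\Downarrow_a$; reduction-closed if $S_1\mathcal R S_2$ and $S_1\rightsquigarrow S_1'$ imply $S_2\rightsquigarrow^* S_2'$ for some $S_2'$ with $S_1'\mathcal R S_2'$; compositional if $S_1\mathcal R S_2$ implies $(S_1,S)\mathcal R(S_2,S)$ for all states $S$; partition-preserving if $(\Gamma_1;\Delta_1)\mathcal R(\Gamma_2;\Delta_2)$ implies (i) if $\Delta_1=\cdot$ then $(\Gamma_2;\Delta_2)\rightsquigarrow^*(\Gamma_2';\cdot)$ for some $\Gamma_2'$ with $(\Gamma_1;\cdot)\mathcal R(\Gamma_2';\cdot)$, and (ii) whenever $(\Gamma_1;\Delta_1)=(S_1',S_1'')$ there are $S_2',S_2''$ with $(\Gamma_2;\Delta_2)\rightsquigarrow^*(S_2',S_2'')$, $S_1'\mathcal R S_2'$ and $S_1''\mathcal R S_2''$. The contextual preorder $\preceq_c$ is the largest relation on states that is barb-preserving, reduction-closed,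 compositional and partition-preserving. -}

module Defs where

open import Data.Nat using (ℕ)
open import Data.List using (List; []; _∷_; _++_)
open import Data.List.Membership.Propositional using (_∈_)
open import Data.List.Relation.Binary.Subset.Propositional using (_⊆_)
open import Data.List.Relation.Binary.Permutation.Propositional using (_↭_)
open import Data.Product using (Σ; ∃; ∃-syntax; _×_; _,_)
open import Function.Bundles using (_⇔_)

Atom : Set
Atom = ℕ

infixr 6 _⊗_
infixr 5 _&_
infixr 4 _⊸_

data Formula : Set where
  atom : Atom → Formula
  𝟏    : Formula
  _⊗_  : Formula → Formula → Formula
  ⊤'   : Formula
  _&_  : Formula → Formula → Formula
  _⊸_  : Atom → Formula → Formula
  !_   : Formula → Formula

-- Contexts are finite multisets, represented by lists; the multiset
-- structure is recovered by the exchange rules (permutation _↭_).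
Ctx : Set
Ctx = List Formula

infix 2 _︔_⊢_

data _︔_⊢_ : Ctx → Ctx → Formula → Set where
  exchΓ : ∀ {Γ Γ' Δ C} → Γ ↭ Γ' → Γ ︔ Δ ⊢ C → Γ' ︔ Δ ⊢ C
  exchΔ : ∀ {Γ Δ Δ' C} → Δ ↭ Δ' → Γ ︔ Δ ⊢ C → Γ ︔ Δ' ⊢ C
  init  : ∀ {Γ a} → Γ ︔ atom a ∷ [] ⊢ atom a
  clone : ∀ {Γ Δ A C} → A ∷ Γ ︔ A ∷ Δ ⊢ C → A ∷ Γ ︔ Δ ⊢ C
  ⊗R    : ∀ {Γ Δ₁ Δ₂ A B} → Γ ︔ Δ₁ ⊢ A → Γ ︔ Δ₂ ⊢ B → Γ ︔ Δ₁ ++ Δ₂ ⊢ A ⊗ B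
  ⊗L    : ∀ {Γ Δ A B C} → Γ ︔ A ∷ B ∷ Δ ⊢ C → Γ ︔ (A ⊗ B) ∷ Δ ⊢ C
  𝟏R    : ∀ {Γ} → Γ ︔ [] ⊢ 𝟏
  𝟏L    : ∀ {Γ Δ C} → Γ ︔ Δ ⊢ C → Γ ︔ 𝟏 ∷ Δ ⊢ C
  &R    : ∀ {Γ Δ A B} → Γ ︔ Δ ⊢ A → Γ ︔ Δ ⊢ B → Γ ︔ Δ ⊢ A & B
  &L₁   : ∀ {Γ Δ A B C} → Γ ︔ A ∷ Δ ⊢ C → Γ ︔ (A & B) ∷ Δ ⊢ C
  &L₂   : ∀ {Γ Δ A B C} → Γ ︔ B ∷ Δ ⊢ C → Γ ︔ (A & B) ∷ Δ ⊢ C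
  ⊤R    : ∀ {Γ Δ} → Γ ︔ Δ ⊢ ⊤'
  ⊸R    : ∀ {Γ Δ a B} → Γ ︔ atom a ∷ Δ ⊢ B → Γ ︔ Δ ⊢ a ⊸ B
  ⊸L    : ∀ {Γ Δ₁ Δ₂ a B C} → Γ ︔ Δ₁ ⊢ atom a → Γ ︔ B ∷ Δ₂ ⊢ C →
          Γ ︔ (a ⊸ B) ∷ (Δ₁ ++ Δ₂) ⊢ C
  !R    : ∀ {Γ A} → Γ ︔ [] ⊢ A → Γ ︔ [] ⊢ ! A
  !L    : ∀ {Γ Δ A C} → A ∷ Γ ︔ Δ ⊢ C → Γ ︔ (! A) ∷ Δ ⊢ C

record State : Set where
  constructor ⟨_︔_⟩
  field
    pers : Ctx
    lin  : Ctx
open State public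

_≼l_ : State → State → Set
⟨ Γ₁ ︔ Δ₁ ⟩ ≼l ⟨ Γ₂ ︔ Δ₂ ⟩ =
  ∀ (Γ' Δ' : Ctx) (C : Formula) →
    (Γ' ++ Γ₁ ︔ Δ' ++ Δ₁ ⊢ C) → (Γ' ++ Γ₂ ︔ Δ' ++ Δ₂ ⊢ C)

-- Structural congruence: Γ as a set, Δ as a multiset.
_≡s_ : State → State → Set
⟨ Γ₁ ︔ Δ₁ ⟩ ≡s ⟨ Γ₂ ︔ Δ₂ ⟩ = (Γ₁ ⊆ Γ₂) × (Γ₂ ⊆ Γ₁) × (Δ₁ ↭ Δ₂)

_∥_ : State → State → State
⟨ Γ₁ ︔ Δ₁ ⟩ ∥ ⟨ Γ₂ ︔ Δ₂ ⟩ = ⟨ Γ₁ ++ Γ₂ ︔ Δ₁ ++ Δ₂ ⟩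

data _⇝₀_ : State → State → Set where
  r⊗ : ∀ {Γ Δ A B} → ⟨ Γ ︔ (A ⊗ B) ∷ Δ ⟩ ⇝₀ ⟨ Γ ︔ A ∷ B ∷ Δ ⟩
  r𝟏 : ∀ {Γ Δ} → ⟨ Γ ︔ 𝟏 ∷ Δ ⟩ ⇝₀ ⟨ Γ ︔ Δ ⟩
  r&₁ : ∀ {Γ Δ A₁ A₂} → ⟨ Γ ︔ (A₁ & A₂) ∷ Δ ⟩ ⇝₀ ⟨ Γ ︔ A₁ ∷ Δ ⟩
  r&₂ : ∀ {Γ Δ A₁ A₂} → ⟨ Γ ︔ (A₁ & A₂) ∷ Δ ⟩ ⇝₀ ⟨ Γ ︔ A₂ ∷ Δ ⟩
  r⊸ : ∀ {Γ Δ a B} → ⟨ Γ ︔ atom a ∷ (a ⊸ B) ∷ Δ ⟩ ⇝₀ ⟨ Γ ︔ B ∷ Δ ⟩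
  r! : ∀ {Γ Δ A} → ⟨ Γ ︔ (! A) ∷ Δ ⟩ ⇝₀ ⟨ A ∷ Γ ︔ Δ ⟩
  rclone : ∀ {Γ Δ A} → ⟨ A ∷ Γ ︔ Δ ⟩ ⇝₀ ⟨ A ∷ Γ ︔ A ∷ Δ ⟩

-- Reduction on states (i.e. on ≡s-classes)
_⇝_ : State → State → Set
S ⇝ S' = ∃[ T ] ∃[ T' ] (S ≡s T) × (T ⇝₀ T') × (T' ≡s S')

data _⇝*_ : State → State → Set where
  ε   : ∀ {S S'} → S ≡s S' → S ⇝* S'
  _◅_ : ∀ {S S' S''} → S ⇝ S' → S' ⇝* S'' → S ⇝* S''

_↓_ : State → Atom → Set
S ↓ a = atom a ∈ lin S

_⇓_ : State → Atom → Set
S ⇓ a = ∃[ S' ] (S ⇝* S') × (S' ↓ a)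

Rel : Set₁
Rel = State → State → Set

RespectsCong : Rel → Set
RespectsCong R = ∀ {S₁ S₁' S₂ S₂'} → S₁ ≡s S₁' → S₂ ≡s S₂' → R S₁ S₂ → R S₁' S₂'

BarbPreserving : Rel → Set
BarbPreserving R = ∀ {S₁ S₂ a} → R S₁ S₂ → S₁ ↓ a → S₂ ⇓ a

ReductionClosed : Rel → Set
ReductionClosed R = ∀ {S₁ S₂ S₁'} → R S₁ S₂ → S₁ ⇝ S₁' →
  ∃[ S₂' ] (S₂ ⇝* S₂') × R S₁' S₂'

Compositional : Rel → Set
Compositional R = ∀ {S₁ S₂} → R S₁ S₂ → ∀ S → R (S₁ ∥ S) (S₂ ∥ S)

PartitionPreserving : Rel → Set
PartitionPreserving R = ∀ {Γ₁ Δ₁ Γ₂ Δ₂} → R ⟨ Γ₁ ︔ Δ₁ ⟩ ⟨ Γ₂ ︔ Δ₂ ⟩ →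
  ( (Δ₁ ↭ [] →
      ∃[ Γ₂' ] (⟨ Γ₂ ︔ Δ₂ ⟩ ⇝* ⟨ Γ₂' ︔ [] ⟩) × R ⟨ Γ₁ ︔ [] ⟩ ⟨ Γ₂' ︔ [] ⟩)
  × (∀ S₁' S₁'' → ⟨ Γ₁ ︔ Δ₁ ⟩ ≡s (S₁' ∥ S₁'') →
      ∃[ S₂' ] ∃[ S₂'' ] (⟨ Γ₂ ︔ Δ₂ ⟩ ⇝* (S₂' ∥ S₂''))
                          × R S₁' S₂' × R S₁'' S₂'') )

record IsContextual (R : Rel) : Set where
  field
    respects    : RespectsCong R
    barb        : BarbPreserving R
    redClosed   : ReductionClosed R
    compos      : Compositional R
    partition   : PartitionPreserving R

-- Contextual preorder: the largest relation with the above properties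
-- (union of all such relations).
_≼c_ : State → State → Set₁
S₁ ≼c S₂ = Σ Rel λ R → IsContextual R × R S₁ S₂

-- ≼c ⊆ ≼l. Every non-right rule of the calculus is a reduction read backwards, so every
-- derivation of Γ ; Δ ⊢ C can be reorganised as a reduction ⟨ Γ ︔ Δ ⟩ ⇝* S' followed by a
-- single right rule at S' ("focusing"). By induction on C, a contextual relation R with S R T
-- then transports S ⊩ C to T ⊩ C: reduction closure follows the reductions, partition
-- preservation matches the splitting of the linear context by ⊗R, 𝟏R and !R, a ⊸ B is tested
-- by composing with the process a, an atom a by composing with the process a ⊸ 𝟏, and
-- A & B needs nothing, &R being invertible.
--
-- ≼l ⊆ ≼c. A state S proves its characteristic formula χ S = ⨂ Δ ⊗ ⨂ !Γ, hence so does T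
-- when S ≼l T. Focusing that proof shows that T reduces to a state whose linear part splits
-- into proofs of the members of Δ and whose persistent part proves every member of Γ; this
-- relation is contextual.

module Submission where

open import Defs
open import Data.List using (List; []; _∷_; _++_; [_])
open import Data.List.Properties using (++-assoc)
open import Data.List.Membership.Propositional using (_∈_)
open import Data.List.Membership.Propositional.Properties using (∈-∃++; ∈-++⁺ˡ; ∈-++⁺ʳ; ∈-++⁻)
open import Data.List.Relation.Unary.Any using (here; there)
open import Data.List.Relation.Binary.Subset.Propositional using (_⊆_)
open import Data.List.Relation.Binary.Subset.Propositional.Properties using (⊆-refl; ⊆-trans; ⊆-reflexive-↭; xs⊆xs++ys; xs⊆ys++xs; ∷⁺ʳ) renaming (++⁺ to ⊆-++⁺)
open import Data.List.Relation.Binary.Permutation.Propositional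
import Data.List.Relation.Binary.Permutation.Propositional.Properties as ↭
open import Data.Product using (∃-syntax; _×_; _,_; proj₁; proj₂)
open import Data.Sum using (_⊎_; inj₁; inj₂; [_,_]′)
open import Data.Empty using (⊥-elim)
open import Function.Base using (id; _∘_)
open import Function.Bundles using (_⇔_; mk⇔)
open import Relation.Binary.PropositionalEquality using (_≡_; _≢_; refl; sym)

module _ {A : Set} where

  ∈⇒↭ : ∀ {x : A} {xs} → x ∈ xs → ∃[ ys ] xs ↭ x ∷ ys
  ∈⇒↭ {x} x∈xs with ys , zs , refl ← ∈-∃++ x∈xs = ys ++ zs , ↭.shift x ys zs

  ↭-shift-under : ∀ xs {ys zs} {z : A} → ys ↭ z ∷ zs → xs ++ ys ↭ z ∷ xs ++ zs
  ↭-shift-under xs {zs = zs} {z} p = ↭-trans (↭.++⁺ˡ xs p) (↭.shift z xs zs)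

  ↭-∷-inv : ∀ {x y : A} {xs ys} → x ∷ xs ↭ y ∷ ys →
    (x ≡ y × xs ↭ ys) ⊎ (∃[ zs ] xs ↭ y ∷ zs × ys ↭ x ∷ zs)
  ↭-∷-inv {x} {y} p with ↭.∈-resp-↭ (↭-sym p) (here refl)
  ... | here refl = inj₁ (refl , ↭.drop-∷ p)
  ... | there y∈xs with zs , q ← ∈⇒↭ y∈xs =
    inj₂ (zs , q , ↭.drop-∷ (↭-trans (↭-sym p) (↭-trans (prep x q) (swap x y ↭-refl))))

  ↭-∷-≢ : ∀ {x y : A} {xs ys} → x ∷ xs ↭ y ∷ ys → x ≢ y → ∃[ zs ] xs ↭ y ∷ zs × ys ↭ x ∷ zs
  ↭-∷-≢ p x≢y with ↭-∷-inv p
  ... | inj₁ (x≡y , _) = ⊥-elim (x≢y x≡y)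
  ... | inj₂ q = q

  ↭-++-inv : ∀ xs {ys zs} {y : A} → xs ++ ys ↭ y ∷ zs →
    (∃[ xs' ] xs ↭ y ∷ xs' × zs ↭ xs' ++ ys) ⊎ (∃[ ys' ] ys ↭ y ∷ ys' × zs ↭ xs ++ ys')
  ↭-++-inv xs {ys} {y = y} p with ∈-++⁻ xs (↭.∈-resp-↭ (↭-sym p) (here refl))
  ... | inj₁ y∈xs with xs' , q ← ∈⇒↭ y∈xs =
    inj₁ (xs' , q , ↭.drop-∷ (↭-trans (↭-sym p) (↭.++⁺ʳ ys q)))
  ... | inj₂ y∈ys with ys' , q ← ∈⇒↭ y∈ys =
    inj₂ (ys' , q , ↭.drop-∷ (↭-trans (↭-sym p) (↭-shift-under xs q)))

  ↭-∷-++-inv : ∀ {x y : A} xs {ys zs} → x ∷ xs ++ ys ↭ y ∷ zs →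
    (x ≡ y × xs ++ ys ↭ zs)
    ⊎ (∃[ xs' ] xs ↭ y ∷ xs' × zs ↭ x ∷ xs' ++ ys)
    ⊎ (∃[ ys' ] ys ↭ y ∷ ys' × zs ↭ x ∷ xs ++ ys')
  ↭-∷-++-inv {x} xs p with ↭-∷-inv p
  ... | inj₁ q = inj₁ q
  ... | inj₂ (zs' , q , r) with ↭-++-inv xs q
  ...   | inj₁ (xs' , s , t) = inj₂ (inj₁ (xs' , s , ↭-trans r (prep x t)))
  ...   | inj₂ (ys' , s , t) = inj₂ (inj₂ (ys' , s , ↭-trans r (prep x t)))

  xs++xs⊆xs : ∀ (xs : List A) → xs ++ xs ⊆ xs
  xs++xs⊆xs xs = [ id , id ]′ ∘ ∈-++⁻ xs

⊢-weaken : ∀ {Γ Γ' Δ C} → Γ ⊆ Γ' → Γ ︔ Δ ⊢ C → Γ' ︔ Δ ⊢ C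
⊢-weaken s (exchΓ p d) = ⊢-weaken (⊆-trans (⊆-reflexive-↭ p) s) d
⊢-weaken s (exchΔ p d) = exchΔ p (⊢-weaken s d)
⊢-weaken s init = init
⊢-weaken s (clone d) with Γ'' , p ← ∈⇒↭ (s (here refl)) =
  exchΓ (↭-sym p) (clone (exchΓ p (⊢-weaken s d)))
⊢-weaken s (⊗R d e) = ⊗R (⊢-weaken s d) (⊢-weaken s e)
⊢-weaken s (⊗L d) = ⊗L (⊢-weaken s d)
⊢-weaken s 𝟏R = 𝟏R
⊢-weaken s (𝟏L d) = 𝟏L (⊢-weaken s d)
⊢-weaken s (&R d e) = &R (⊢-weaken s d) (⊢-weaken s e)
⊢-weaken s (&L₁ d) = &L₁ (⊢-weaken s d)
⊢-weaken s (&L₂ d) = &L₂ (⊢-weaken s d)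
⊢-weaken s ⊤R = ⊤R
⊢-weaken s (⊸R d) = ⊸R (⊢-weaken s d)
⊢-weaken s (⊸L d e) = ⊸L (⊢-weaken s d) (⊢-weaken s e)
⊢-weaken s (!R d) = !R (⊢-weaken s d)
⊢-weaken s (!L d) = !L (⊢-weaken (∷⁺ʳ _ s) d)

⊢-id : ∀ {Γ} A → Γ ︔ [ A ] ⊢ A
⊢-id (atom a) = init
⊢-id 𝟏 = 𝟏L 𝟏R
⊢-id (A ⊗ B) = ⊗L (⊗R (⊢-id A) (⊢-id B))
⊢-id ⊤' = ⊤R
⊢-id (A & B) = &R (&L₁ (⊢-id A)) (&L₂ (⊢-id B))
⊢-id (a ⊸ B) = ⊸R (exchΔ (swap _ _ ↭-refl) (⊸L init (⊢-id B)))
⊢-id (! A) = !L (!R (clone (⊢-id A)))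

⊢-pers : ∀ {Γ A} → A ∈ Γ → Γ ︔ [] ⊢ A
⊢-pers {A = A} A∈Γ with _ , p ← ∈⇒↭ A∈Γ = exchΓ (↭-sym p) (clone (⊢-id A))

infix 2 _⊩_

_⊩_ : State → Formula → Set
S ⊩ C = pers S ︔ lin S ⊢ C

≡s-refl : ∀ {S} → S ≡s S
≡s-refl = ⊆-refl , ⊆-refl , ↭-refl

≡s-sym : ∀ {S S'} → S ≡s S' → S' ≡s S
≡s-sym (s , t , p) = t , s , ↭-sym p

≡s-trans : ∀ {S S' S''} → S ≡s S' → S' ≡s S'' → S ≡s S''
≡s-trans (s , t , p) (s' , t' , p') = ⊆-trans s s' , ⊆-trans t' t , ↭-trans p p'

≡s-pers : ∀ {Γ Γ' Δ} → Γ ↭ Γ' → ⟨ Γ ︔ Δ ⟩ ≡s ⟨ Γ' ︔ Δ ⟩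
≡s-pers p = ⊆-reflexive-↭ p , ⊆-reflexive-↭ (↭-sym p) , ↭-refl

≡s-lin : ∀ {Γ Δ Δ'} → Δ ↭ Δ' → ⟨ Γ ︔ Δ ⟩ ≡s ⟨ Γ ︔ Δ' ⟩
≡s-lin p = ⊆-refl , ⊆-refl , p

≡s-split : ∀ {Γ} Δ₁ {Δ₂} → ⟨ Γ ︔ Δ₁ ++ Δ₂ ⟩ ≡s (⟨ Γ ︔ Δ₁ ⟩ ∥ ⟨ Γ ︔ Δ₂ ⟩)
≡s-split {Γ} _ = xs⊆xs++ys Γ Γ , xs++xs⊆xs Γ , ↭-refl

≡s-∷-∥ : ∀ {S} X → ⟨ pers S ︔ X ∷ lin S ⟩ ≡s (S ∥ ⟨ [] ︔ [ X ] ⟩)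
≡s-∷-∥ {S} X = xs⊆xs++ys (pers S) [] , [ id , (λ ()) ]′ ∘ ∈-++⁻ (pers S) , ↭.++-comm [ X ] (lin S)

∥-congʳ : ∀ {S S' T} → S ≡s S' → (S ∥ T) ≡s (S' ∥ T)
∥-congʳ (s , t , p) = ⊆-++⁺ s ⊆-refl , ⊆-++⁺ t ⊆-refl , ↭.++⁺ʳ _ p

∥-comm : ∀ S T → (S ∥ T) ≡s (T ∥ S)
∥-comm S T =
  ⊆-reflexive-↭ (↭.++-comm (pers S) (pers T)) ,
  ⊆-reflexive-↭ (↭.++-comm (pers T) (pers S)) ,
  ↭.++-comm (lin S) (lin T)

⊩-resp-≡s : ∀ {S S' C} → S ≡s S' → S ⊩ C → S' ⊩ C
⊩-resp-≡s (s , _ , p) d = exchΔ p (⊢-weaken s d)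

⇝*-refl : ∀ {S} → S ⇝* S
⇝*-refl = ε ≡s-refl

⇝*-respˡ-≡s : ∀ {S S' X} → S ≡s S' → S' ⇝* X → S ⇝* X
⇝*-respˡ-≡s e (ε e') = ε (≡s-trans e e')
⇝*-respˡ-≡s e ((T , T' , e₁ , r , e₂) ◅ rs) = (T , T' , ≡s-trans e e₁ , r , e₂) ◅ rs

⇝*-respʳ-≡s : ∀ {S X X'} → S ⇝* X → X ≡s X' → S ⇝* X'
⇝*-respʳ-≡s (ε e') e = ε (≡s-trans e' e)
⇝*-respʳ-≡s (r ◅ rs) e = r ◅ ⇝*-respʳ-≡s rs e

⇝*-trans : ∀ {S S' S''} → S ⇝* S' → S' ⇝* S'' → S ⇝* S''
⇝*-trans (ε e) q = ⇝*-respˡ-≡s e q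
⇝*-trans (r ◅ p) q = r ◅ ⇝*-trans p q

⇝₀⇒⇝* : ∀ {S S'} → S ⇝₀ S' → S ⇝* S'
⇝₀⇒⇝* r = (_ , _ , ≡s-refl , r , ≡s-refl) ◅ ⇝*-refl

⇝₀-∥ˡ : ∀ {S S' T} → S ⇝₀ S' → (S ∥ T) ⇝₀ (S' ∥ T)
⇝₀-∥ˡ r⊗ = r⊗
⇝₀-∥ˡ r𝟏 = r𝟏
⇝₀-∥ˡ r&₁ = r&₁
⇝₀-∥ˡ r&₂ = r&₂
⇝₀-∥ˡ r⊸ = r⊸
⇝₀-∥ˡ r! = r!
⇝₀-∥ˡ rclone = rclone

⇝*-∥ˡ : ∀ {S S' T} → S ⇝* S' → (S ∥ T) ⇝* (S' ∥ T)
⇝*-∥ˡ (ε e) = ε (∥-congʳ e)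
⇝*-∥ˡ ((_ , _ , e₁ , r , e₂) ◅ p) = (_ , _ , ∥-congʳ e₁ , ⇝₀-∥ˡ r , ∥-congʳ e₂) ◅ ⇝*-∥ˡ p

⇝*-∥ : ∀ {S S' T T'} → S ⇝* S' → T ⇝* T' → (S ∥ T) ⇝* (S' ∥ T')
⇝*-∥ {S' = S'} {T} {T'} p q =
  ⇝*-trans (⇝*-∥ˡ p) (⇝*-respˡ-≡s (∥-comm S' T) (⇝*-respʳ-≡s (⇝*-∥ˡ q) (∥-comm T' S')))

⇝*-split : ∀ {Γ Δ₁ Δ₂ S₁ S₂} → ⟨ Γ ︔ Δ₁ ⟩ ⇝* S₁ → ⟨ Γ ︔ Δ₂ ⟩ ⇝* S₂ → ⟨ Γ ︔ Δ₁ ++ Δ₂ ⟩ ⇝* (S₁ ∥ S₂)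
⇝*-split {Γ} {Δ₁} {Δ₂} p q = ⇝*-respˡ-≡s (≡s-split {Γ} Δ₁) (⇝*-∥ p q)

⊩-expand₀ : ∀ {S S' C} → S ⇝₀ S' → S' ⊩ C → S ⊩ C
⊩-expand₀ r⊗ d = ⊗L d
⊩-expand₀ r𝟏 d = 𝟏L d
⊩-expand₀ r&₁ d = &L₁ d
⊩-expand₀ r&₂ d = &L₂ d
⊩-expand₀ r⊸ d = exchΔ (swap _ _ ↭-refl) (⊸L init d)
⊩-expand₀ r! d = !L d
⊩-expand₀ rclone d = clone d

⊩-expand : ∀ {S S' C} → S ⇝* S' → S' ⊩ C → S ⊩ C
⊩-expand (ε e) d = ⊩-resp-≡s (≡s-sym e) d
⊩-expand ((_ , _ , e₁ , r , e₂) ◅ p) d =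
  ⊩-resp-≡s (≡s-sym e₁) (⊩-expand₀ r (⊩-resp-≡s (≡s-sym e₂) (⊩-expand p d)))

data RightRule : State → Formula → Set where
  init : ∀ {Γ a} → RightRule ⟨ Γ ︔ [ atom a ] ⟩ (atom a)
  ⊗R   : ∀ {Γ Δ₁ Δ₂ A B} → Γ ︔ Δ₁ ⊢ A → Γ ︔ Δ₂ ⊢ B → RightRule ⟨ Γ ︔ Δ₁ ++ Δ₂ ⟩ (A ⊗ B)
  𝟏R   : ∀ {Γ} → RightRule ⟨ Γ ︔ [] ⟩ 𝟏
  &R   : ∀ {Γ Δ A B} → Γ ︔ Δ ⊢ A → Γ ︔ Δ ⊢ B → RightRule ⟨ Γ ︔ Δ ⟩ (A & B)
  ⊤R   : ∀ {S} → RightRule S ⊤'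
  ⊸R   : ∀ {Γ Δ a B} → Γ ︔ atom a ∷ Δ ⊢ B → RightRule ⟨ Γ ︔ Δ ⟩ (a ⊸ B)
  !R   : ∀ {Γ A} → Γ ︔ [] ⊢ A → RightRule ⟨ Γ ︔ [] ⟩ (! A)

Focus : State → Formula → Set
Focus S C = ∃[ S' ] S ⇝* S' × RightRule S' C

RightRule-weaken : ∀ {S C} G → RightRule S C → RightRule (⟨ G ︔ [] ⟩ ∥ S) C
RightRule-weaken G init = init
RightRule-weaken G (⊗R {Γ} d e) = ⊗R (⊢-weaken (xs⊆ys++xs Γ G) d) (⊢-weaken (xs⊆ys++xs Γ G) e)
RightRule-weaken G 𝟏R = 𝟏R
RightRule-weaken G (&R {Γ} d e) = &R (⊢-weaken (xs⊆ys++xs Γ G) d) (⊢-weaken (xs⊆ys++xs Γ G) e)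
RightRule-weaken G ⊤R = ⊤R
RightRule-weaken G (⊸R {Γ} d) = ⊸R (⊢-weaken (xs⊆ys++xs Γ G) d)
RightRule-weaken G (!R {Γ} d) = !R (⊢-weaken (xs⊆ys++xs Γ G) d)

focus-⇝* : ∀ {S S' C} → S ⇝* S' → Focus S' C → Focus S C
focus-⇝* p (S'' , q , r) = S'' , ⇝*-trans p q , r

⇝*-⊸ : ∀ {Γ Γ₁ Δ₁ Δ₂ a B} → ⟨ Γ ︔ Δ₁ ⟩ ⇝* ⟨ Γ₁ ︔ [ atom a ] ⟩ →
  ⟨ Γ ︔ (a ⊸ B) ∷ (Δ₁ ++ Δ₂) ⟩ ⇝* ⟨ Γ₁ ++ Γ ︔ B ∷ Δ₂ ⟩
⇝*-⊸ {Δ₁ = Δ₁} {Δ₂} {a} {B} p =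
  ⇝*-respˡ-≡s (≡s-lin (↭-sym (↭.shift (a ⊸ B) Δ₁ Δ₂)))
    (⇝*-trans (⇝*-split p ⇝*-refl) (⇝₀⇒⇝* r⊸))

focus : ∀ {Γ Δ C} → Γ ︔ Δ ⊢ C → Focus ⟨ Γ ︔ Δ ⟩ C
focus (exchΓ p d) = focus-⇝* (ε (≡s-pers (↭-sym p))) (focus d)
focus (exchΔ p d) = focus-⇝* (ε (≡s-lin (↭-sym p))) (focus d)
focus init = _ , ⇝*-refl , init
focus (clone d) = focus-⇝* (⇝₀⇒⇝* rclone) (focus d)
focus (⊗R d e) = _ , ⇝*-refl , ⊗R d e
focus (⊗L d) = focus-⇝* (⇝₀⇒⇝* r⊗) (focus d)
focus 𝟏R = _ , ⇝*-refl , 𝟏R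
focus (𝟏L d) = focus-⇝* (⇝₀⇒⇝* r𝟏) (focus d)
focus (&R d e) = _ , ⇝*-refl , &R d e
focus (&L₁ d) = focus-⇝* (⇝₀⇒⇝* r&₁) (focus d)
focus (&L₂ d) = focus-⇝* (⇝₀⇒⇝* r&₂) (focus d)
focus ⊤R = _ , ⇝*-refl , ⊤R
focus (⊸R d) = _ , ⇝*-refl , ⊸R d
-- ⊸L becomes a reduction once its atomic premise has been focused down to the atom itself.
focus (⊸L d e) with focus d | focus e
... | _ , p , init {Γ₁} | _ , q , r =
  _ , ⇝*-trans (⇝*-⊸ p) (⇝*-∥ (⇝*-refl {⟨ Γ₁ ︔ [] ⟩}) q) , RightRule-weaken Γ₁ r
focus (!R d) = _ , ⇝*-refl , !R d
focus (!L d) = focus-⇝* (⇝₀⇒⇝* r!) (focus d)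

&R-inv₁ : ∀ {Γ Δ A B} → Γ ︔ Δ ⊢ A & B → Γ ︔ Δ ⊢ A
&R-inv₁ d with _ , p , &R d₁ _ ← focus d = ⊩-expand p d₁

&R-inv₂ : ∀ {Γ Δ A B} → Γ ︔ Δ ⊢ A & B → Γ ︔ Δ ⊢ B
&R-inv₂ d with _ , p , &R _ d₂ ← focus d = ⊩-expand p d₂

⊸R-inv : ∀ {Γ Δ a B} → Γ ︔ Δ ⊢ a ⊸ B → Γ ︔ atom a ∷ Δ ⊢ B
⊸R-inv {Γ} d with _ , p , ⊸R {Γ'} d' ← focus d =
  ⊩-expand (⇝*-split (⇝*-refl {⟨ Γ ︔ [ _ ] ⟩}) p) (⊢-weaken (xs⊆ys++xs Γ' Γ) d')

⊸-elim : ∀ {Γ Δ₁ Δ₂ a B} → Γ ︔ Δ₁ ⊢ atom a → Γ ︔ Δ₂ ⊢ a ⊸ B → Γ ︔ Δ₁ ++ Δ₂ ⊢ B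
⊸-elim {Γ} d e with _ , p , init {Γ₁} ← focus d =
  ⊩-expand (⇝*-split p ⇝*-refl) (⊢-weaken (xs⊆ys++xs Γ Γ₁) (⊸R-inv e))

⊗𝟏R-inv : ∀ {Γ Δ A} → Γ ︔ Δ ⊢ A ⊗ 𝟏 → Γ ︔ Δ ⊢ A
⊗𝟏R-inv d with _ , p , ⊗R {Γ'} {Δ₁} d₁ d₂ ← focus d with _ , q , 𝟏R {Γ₂} ← focus d₂ =
  ⊩-expand (⇝*-trans p (⇝*-split ⇝*-refl q))
    (exchΔ (↭-sym (↭.++-identityʳ Δ₁)) (⊢-weaken (xs⊆xs++ys Γ' Γ₂) d₁))

𝟏L-inv : ∀ {Γ Δ Δ₀ C} → Γ ︔ Δ ⊢ C → Δ ↭ 𝟏 ∷ Δ₀ → Γ ︔ Δ₀ ⊢ C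
𝟏L-inv (exchΓ p d) q = exchΓ p (𝟏L-inv d q)
𝟏L-inv (exchΔ p d) q = 𝟏L-inv d (↭-trans p q)
𝟏L-inv init q with () ← ↭.↭-singleton-inv (↭-sym q)
𝟏L-inv (clone d) q = clone (𝟏L-inv d (↭-shift-under [ _ ] q))
𝟏L-inv (⊗R {Δ₁ = Δ₁} d e) q with ↭-++-inv Δ₁ q
... | inj₁ (_ , p , r) = exchΔ (↭-sym r) (⊗R (𝟏L-inv d p) e)
... | inj₂ (_ , p , r) = exchΔ (↭-sym r) (⊗R d (𝟏L-inv e p))
𝟏L-inv (⊗L d) q with _ , p , r ← ↭-∷-≢ q (λ ()) =
  exchΔ (↭-sym r) (⊗L (𝟏L-inv d (↭-shift-under (_ ∷ [ _ ]) p)))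
𝟏L-inv 𝟏R q with () ← ↭.↭-empty-inv (↭-sym q)
𝟏L-inv (𝟏L d) q = exchΔ (↭.drop-∷ q) d
𝟏L-inv (&R d e) q = &R (𝟏L-inv d q) (𝟏L-inv e q)
𝟏L-inv (&L₁ d) q with _ , p , r ← ↭-∷-≢ q (λ ()) =
  exchΔ (↭-sym r) (&L₁ (𝟏L-inv d (↭-shift-under [ _ ] p)))
𝟏L-inv (&L₂ d) q with _ , p , r ← ↭-∷-≢ q (λ ()) =
  exchΔ (↭-sym r) (&L₂ (𝟏L-inv d (↭-shift-under [ _ ] p)))
𝟏L-inv ⊤R q = ⊤R
𝟏L-inv (⊸R d) q = ⊸R (𝟏L-inv d (↭-shift-under [ _ ] q))
𝟏L-inv (⊸L {Δ₁ = Δ₁} d e) q with ↭-∷-++-inv Δ₁ q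
... | inj₁ (() , _)
... | inj₂ (inj₁ (_ , p , r)) = exchΔ (↭-sym r) (⊸L (𝟏L-inv d p) e)
... | inj₂ (inj₂ (_ , p , r)) = exchΔ (↭-sym r) (⊸L d (𝟏L-inv e (↭-shift-under [ _ ] p)))
𝟏L-inv (!R d) q with () ← ↭.↭-empty-inv (↭-sym q)
𝟏L-inv (!L d) q with _ , p , r ← ↭-∷-≢ q (λ ()) = exchΔ (↭-sym r) (!L (𝟏L-inv d p))

⊸L-⊗ʳ : ∀ {Γ Δ₁ Δ₂ a b B C} → Γ ︔ Δ₁ ⊢ atom a ⊗ atom b → Γ ︔ B ∷ Δ₂ ⊢ C →
  Γ ︔ (b ⊸ B) ∷ (Δ₁ ++ Δ₂) ⊢ atom a ⊗ C
⊸L-⊗ʳ {Γ} {Δ₁} {Δ₂} {b = b} {B} d e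
  with _ , p , ⊗R d₁ d₂ ← focus d
  with _ , p₁ , init {Γ₁} ← focus d₁ | _ , p₂ , init {Γ₂} ← focus d₂ =
  ⊩-expand (⇝*-respˡ-≡s (≡s-lin (↭-sym (↭.shift (b ⊸ B) Δ₁ Δ₂)))
              (⇝*-split (⇝*-trans p (⇝*-split p₁ p₂)) ⇝*-refl))
    (exchΔ (prep _ (swap _ _ ↭-refl)) (⊗R init (⊸L init (⊢-weaken (xs⊆ys++xs Γ (Γ₁ ++ Γ₂)) e))))

data Atom∨𝟏 : Formula → Set where
  is-atom : ∀ {a} → Atom∨𝟏 (atom a)
  is-𝟏    : Atom∨𝟏 𝟏

-- The atom a that a ⊸ 𝟏 would have consumed is produced alongside C instead.
⊸𝟏L-inv : ∀ {Γ Δ Δ₀ C a} → Atom∨𝟏 C → Γ ︔ Δ ⊢ C → Δ ↭ (a ⊸ 𝟏) ∷ Δ₀ → Γ ︔ Δ₀ ⊢ atom a ⊗ C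
⊸𝟏L-inv c (exchΓ p d) q = exchΓ p (⊸𝟏L-inv c d q)
⊸𝟏L-inv c (exchΔ p d) q = ⊸𝟏L-inv c d (↭-trans p q)
⊸𝟏L-inv c init q with () ← ↭.↭-singleton-inv (↭-sym q)
⊸𝟏L-inv c (clone d) q = clone (⊸𝟏L-inv c d (↭-shift-under [ _ ] q))
⊸𝟏L-inv () (⊗R d e) q
⊸𝟏L-inv c (⊗L d) q with _ , p , r ← ↭-∷-≢ q (λ ()) =
  exchΔ (↭-sym r) (⊗L (⊸𝟏L-inv c d (↭-shift-under (_ ∷ [ _ ]) p)))
⊸𝟏L-inv c 𝟏R q with () ← ↭.↭-empty-inv (↭-sym q)
⊸𝟏L-inv c (𝟏L d) q with _ , p , r ← ↭-∷-≢ q (λ ()) = exchΔ (↭-sym r) (𝟏L (⊸𝟏L-inv c d p))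
⊸𝟏L-inv () (&R d e) q
⊸𝟏L-inv c (&L₁ d) q with _ , p , r ← ↭-∷-≢ q (λ ()) =
  exchΔ (↭-sym r) (&L₁ (⊸𝟏L-inv c d (↭-shift-under [ _ ] p)))
⊸𝟏L-inv c (&L₂ d) q with _ , p , r ← ↭-∷-≢ q (λ ()) =
  exchΔ (↭-sym r) (&L₂ (⊸𝟏L-inv c d (↭-shift-under [ _ ] p)))
⊸𝟏L-inv () ⊤R q
⊸𝟏L-inv () (⊸R d) q
⊸𝟏L-inv c (⊸L {Δ₁ = Δ₁} d e) q with ↭-∷-++-inv Δ₁ q
... | inj₁ (refl , r) = exchΔ r (⊗R d (𝟏L-inv e ↭-refl))
... | inj₂ (inj₁ (_ , p , r)) = exchΔ (↭-sym r) (⊸L-⊗ʳ (⊸𝟏L-inv is-atom d p) e)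
... | inj₂ (inj₂ (_ , p , r)) = exchΔ (↭-sym r) (⊸L d (⊸𝟏L-inv c e (↭-shift-under [ _ ] p)))
⊸𝟏L-inv () (!R d) q
⊸𝟏L-inv c (!L d) q with _ , p , r ← ↭-∷-≢ q (λ ()) = exchΔ (↭-sym r) (!L (⊸𝟏L-inv c d p))

∥-identityʳ : ∀ S → (S ∥ ⟨ [] ︔ [] ⟩) ≡s S
∥-identityʳ S = ≡s-trans (≡s-lin (↭.++-identityʳ (lin S))) (≡s-pers (↭.++-identityʳ (pers S)))

module _ {R : Rel} (R-contextual : IsContextual R) where
  open IsContextual R-contextual

  redClosed* : ∀ {S T S'} → R S T → S ⇝* S' → ∃[ T' ] T ⇝* T' × R S' T'
  redClosed* r (ε e) = _ , ⇝*-refl , respects e ≡s-refl r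
  redClosed* r (s ◅ p) with _ , q , r₁ ← redClosed r s with _ , q' , r' ← redClosed* r₁ p =
    _ , ⇝*-trans q q' , r'

  contextual-preserves-𝟏 : ∀ {S T} → R S T → S ⊩ 𝟏 → T ⊩ 𝟏
  contextual-preserves-𝟏 r d
    with _ , p , 𝟏R ← focus d
    with _ , q , r' ← redClosed* r p
    with _ , q' , _ ← proj₁ (partition r') ↭-refl =
    ⊩-expand (⇝*-trans q q') 𝟏R

  contextual-preserves-⊩ : ∀ C {S T} → R S T → S ⊩ C → T ⊩ C
  contextual-preserves-⊩ (atom a) {S} {T} r d =
    ⊩-resp-≡s (∥-identityʳ T) (⊗𝟏R-inv (⊸𝟏L-inv is-𝟏 T∥test⊩𝟏 (↭.shift _ (lin T) [])))
    where
    T∥test⊩𝟏 : (T ∥ ⟨ [] ︔ [ a ⊸ 𝟏 ] ⟩) ⊩ 𝟏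
    T∥test⊩𝟏 = contextual-preserves-𝟏 (compos r _)
      (exchΔ (↭-sym (↭.shift _ (lin S) [])) (⊸L (⊢-weaken (xs⊆xs++ys (pers S) []) d) (𝟏L 𝟏R)))
  contextual-preserves-⊩ 𝟏 r d = contextual-preserves-𝟏 r d
  contextual-preserves-⊩ (A ⊗ B) r d
    with _ , p , ⊗R {Γ'} {Δ₁} {Δ₂} d₁ d₂ ← focus d
    with _ , q , r' ← redClosed* r p
    with T₁ , T₂ , q' , r₁ , r₂ ← proj₂ (partition r') ⟨ Γ' ︔ Δ₁ ⟩ ⟨ Γ' ︔ Δ₂ ⟩ (≡s-split Δ₁) =
    ⊩-expand (⇝*-trans q q')
      (⊗R (⊢-weaken (xs⊆xs++ys (pers T₁) (pers T₂)) (contextual-preserves-⊩ A r₁ d₁))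
          (⊢-weaken (xs⊆ys++xs (pers T₂) (pers T₁)) (contextual-preserves-⊩ B r₂ d₂)))
  contextual-preserves-⊩ ⊤' r d = ⊤R
  contextual-preserves-⊩ (A & B) r d =
    &R (contextual-preserves-⊩ A r (&R-inv₁ d)) (contextual-preserves-⊩ B r (&R-inv₂ d))
  contextual-preserves-⊩ (a ⊸ B) {S} {T} r d =
    ⊸R (⊩-resp-≡s (≡s-sym (≡s-∷-∥ {T} (atom a)))
      (contextual-preserves-⊩ B (compos r _) (⊩-resp-≡s (≡s-∷-∥ {S} (atom a)) (⊸R-inv d))))
  contextual-preserves-⊩ (! A) r d
    with _ , p , !R d' ← focus d
    with _ , q , r' ← redClosed* r p
    with _ , q' , r'' ← proj₁ (partition r') ↭-refl =
    ⊩-expand (⇝*-trans q q') (!R (contextual-preserves-⊩ A r'' d'))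

≼c⇒≼l : ∀ {S₁ S₂} → S₁ ≼c S₂ → S₁ ≼l S₂
≼c⇒≼l {S₁} {S₂} (R , R-contextual , r) Γ' Δ' C d =
  ⊩-resp-≡s (∥-comm S₂ ⟨ Γ' ︔ Δ' ⟩)
    (contextual-preserves-⊩ R-contextual C (IsContextual.compos R-contextual r ⟨ Γ' ︔ Δ' ⟩)
      (⊩-resp-≡s (∥-comm ⟨ Γ' ︔ Δ' ⟩ S₁) d))

infix 2 _︔_⊢*_ _⊢!_

data _︔_⊢*_ (Γ : Ctx) : Ctx → Ctx → Set where
  []  : Γ ︔ [] ⊢* []
  _∷_ : ∀ {P Q A Δ} → Γ ︔ P ⊢ A → Γ ︔ Q ⊢* Δ → Γ ︔ P ++ Q ⊢* A ∷ Δ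

⊢*-weaken : ∀ {Γ Γ' P Δ} → Γ ⊆ Γ' → Γ ︔ P ⊢* Δ → Γ' ︔ P ⊢* Δ
⊢*-weaken s [] = []
⊢*-weaken s (d ∷ ds) = ⊢-weaken s d ∷ ⊢*-weaken s ds

⊢*-id : ∀ {Γ} Δ → Γ ︔ Δ ⊢* Δ
⊢*-id [] = []
⊢*-id (A ∷ Δ) = ⊢-id A ∷ ⊢*-id Δ

⊢*-++ : ∀ {Γ P Q Δ Δ'} → Γ ︔ P ⊢* Δ → Γ ︔ Q ⊢* Δ' → Γ ︔ P ++ Q ⊢* Δ ++ Δ'
⊢*-++ [] es = es
⊢*-++ {Q = Q} (_∷_ {P₁} {P₂} d ds) es rewrite ++-assoc P₁ P₂ Q = d ∷ ⊢*-++ ds es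

⊢*-split : ∀ {Γ P} Δ₁ {Δ₂} → Γ ︔ P ⊢* Δ₁ ++ Δ₂ →
  ∃[ P₁ ] ∃[ P₂ ] P ≡ P₁ ++ P₂ × (Γ ︔ P₁ ⊢* Δ₁) × (Γ ︔ P₂ ⊢* Δ₂)
⊢*-split [] ds = [] , _ , refl , [] , ds
⊢*-split (A ∷ Δ₁) (_∷_ {P} d ds) with Q₁ , Q₂ , refl , ds₁ , ds₂ ← ⊢*-split Δ₁ ds =
  P ++ Q₁ , Q₂ , sym (++-assoc P Q₁ Q₂) , d ∷ ds₁ , ds₂

⊢*-perm : ∀ {Γ P Δ Δ'} → Γ ︔ P ⊢* Δ → Δ ↭ Δ' → ∃[ P' ] P ↭ P' × (Γ ︔ P' ⊢* Δ')
⊢*-perm ds refl = _ , ↭-refl , ds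
⊢*-perm (_∷_ {P} d ds) (prep _ p) with _ , q , ds' ← ⊢*-perm ds p = _ , ↭.++⁺ˡ P q , d ∷ ds'
⊢*-perm (_∷_ {P₁} d₁ (_∷_ {P₂} d₂ ds)) (swap _ _ p) with _ , q , ds' ← ⊢*-perm ds p =
  _ , ↭-trans (↭.shifts P₁ P₂) (↭.++⁺ˡ P₂ (↭.++⁺ˡ P₁ q)) , d₂ ∷ (d₁ ∷ ds')
⊢*-perm ds (trans p p') with _ , q , ds' ← ⊢*-perm ds p with _ , q' , ds'' ← ⊢*-perm ds' p' =
  _ , ↭-trans q q' , ds''

⊢*-∈ : ∀ {Γ P Δ A} → Γ ︔ P ⊢* Δ → A ∈ Δ → ∃[ P₁ ] ∃[ Q ] P ↭ P₁ ++ Q × (Γ ︔ P₁ ⊢ A)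
⊢*-∈ (_∷_ {P} {Q} d ds) (here refl) = P , Q , ↭-refl , d
⊢*-∈ (_∷_ {P} d ds) (there A∈Δ) with P₁ , Q , p , d' ← ⊢*-∈ ds A∈Δ =
  P₁ , P ++ Q , ↭-trans (↭.++⁺ˡ P p) (↭.shifts P P₁) , d'

_⊢!_ : Ctx → Ctx → Set
Γ ⊢! Γ₁ = ∀ {B} → B ∈ Γ₁ → Γ ︔ [] ⊢ B

⊢!-weaken : ∀ {Γ Γ' Γ₁} → Γ ⊆ Γ' → Γ ⊢! Γ₁ → Γ' ⊢! Γ₁
⊢!-weaken s ds = ⊢-weaken s ∘ ds

⊢!-++ : ∀ {Γ} Γ₁ {Γ₂} → Γ ⊢! Γ₁ → Γ ⊢! Γ₂ → Γ ⊢! Γ₁ ++ Γ₂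
⊢!-++ Γ₁ ds es = [ ds , es ]′ ∘ ∈-++⁻ Γ₁

⊢!-∷ : ∀ {Γ B Γ₁} → Γ ︔ [] ⊢ B → Γ ⊢! Γ₁ → Γ ⊢! B ∷ Γ₁
⊢!-∷ d ds (here refl) = d
⊢!-∷ d ds (there B∈Γ₁) = ds B∈Γ₁

⨂ : Ctx → Formula
⨂ [] = 𝟏
⨂ (A ∷ Δ) = A ⊗ ⨂ Δ

⨂! : Ctx → Formula
⨂! [] = 𝟏
⨂! (B ∷ Γ) = (! B) ⊗ ⨂! Γ

χ : State → Formula
χ S = ⨂ (lin S) ⊗ ⨂! (pers S)

⊢-⨂ : ∀ {Γ} Δ → Γ ︔ Δ ⊢ ⨂ Δ
⊢-⨂ [] = 𝟏R
⊢-⨂ (A ∷ Δ) = ⊗R (⊢-id A) (⊢-⨂ Δ)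

⊢-⨂! : ∀ {Γ} Γ₁ → Γ ⊢! Γ₁ → Γ ︔ [] ⊢ ⨂! Γ₁
⊢-⨂! [] ds = 𝟏R
⊢-⨂! (B ∷ Γ₁) ds = ⊗R (!R (ds (here refl))) (⊢-⨂! Γ₁ (ds ∘ there))

⊩-χ : ∀ S → S ⊩ χ S
⊩-χ S = exchΔ (↭.++-identityʳ (lin S)) (⊗R (⊢-⨂ (lin S)) (⊢-⨂! (pers S) ⊢-pers))

⨂-focus : ∀ {Γ Δ} Δ₁ → Γ ︔ Δ ⊢ ⨂ Δ₁ → ∃[ Γ' ] ∃[ P ] (⟨ Γ ︔ Δ ⟩ ⇝* ⟨ Γ' ︔ P ⟩) × (Γ' ︔ P ⊢* Δ₁)
⨂-focus [] d with _ , p , 𝟏R ← focus d = _ , [] , p , []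
⨂-focus (A ∷ Δ₁) d
  with _ , p , ⊗R {Γ'} {P₁} d₁ d₂ ← focus d
  with Γ'' , P₂ , q , ds ← ⨂-focus Δ₁ d₂ =
  Γ' ++ Γ'' , P₁ ++ P₂ , ⇝*-trans p (⇝*-split ⇝*-refl q) ,
  ⊢-weaken (xs⊆xs++ys Γ' Γ'') d₁ ∷ ⊢*-weaken (xs⊆ys++xs Γ'' Γ') ds

⨂!-focus : ∀ {Γ Δ} Γ₁ → Γ ︔ Δ ⊢ ⨂! Γ₁ → ∃[ Γ' ] (⟨ Γ ︔ Δ ⟩ ⇝* ⟨ Γ' ︔ [] ⟩) × (Γ' ⊢! Γ₁)
⨂!-focus [] d with _ , p , 𝟏R ← focus d = _ , p , λ ()
⨂!-focus (B ∷ Γ₁) d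
  with _ , p , ⊗R d₁ d₂ ← focus d
  with _ , p₁ , !R {Γ'} d' ← focus d₁ | Γ'' , p₂ , ds ← ⨂!-focus Γ₁ d₂ =
  Γ' ++ Γ'' , ⇝*-trans p (⇝*-split p₁ p₂) ,
  ⊢!-∷ (⊢-weaken (xs⊆xs++ys Γ' Γ'') d') (⊢!-weaken (xs⊆ys++xs Γ'' Γ') ds)

_≼ₚ_ : Rel
S ≼ₚ T = ∃[ Γ' ] ∃[ P ] (T ⇝* ⟨ Γ' ︔ P ⟩) × (Γ' ︔ P ⊢* lin S) × (Γ' ⊢! pers S)

≼l⇒≼ₚ : ∀ {S T} → S ≼l T → S ≼ₚ T
≼l⇒≼ₚ {S} h
  with _ , p , ⊗R d₁ d₂ ← focus (h [] [] (χ S) (⊩-χ S))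
  with Γ₁ , P , p₁ , ds ← ⨂-focus (lin S) d₁ | Γ₂ , p₂ , es ← ⨂!-focus (pers S) d₂ =
  Γ₁ ++ Γ₂ , P ,
  ⇝*-respʳ-≡s (⇝*-trans p (⇝*-split p₁ p₂)) (≡s-lin (↭.++-identityʳ P)) ,
  ⊢*-weaken (xs⊆xs++ys Γ₁ Γ₂) ds , ⊢!-weaken (xs⊆ys++xs Γ₂ Γ₁) es

≼ₚ-respects : RespectsCong _≼ₚ_
≼ₚ-respects (_ , Γ₁'⊆Γ₁ , Δ₁↭Δ₁') e (Γ' , P , p , ds , es) with P' , q , ds' ← ⊢*-perm ds Δ₁↭Δ₁' =
  Γ' , P' , ⇝*-respˡ-≡s (≡s-sym e) (⇝*-respʳ-≡s p (≡s-lin q)) , ds' , es ∘ Γ₁'⊆Γ₁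

≼ₚ-barb : BarbPreserving _≼ₚ_
≼ₚ-barb (Γ' , P , p , ds , es) a∈Δ₁
  with P₁ , Q , q , d ← ⊢*-∈ ds a∈Δ₁
  with _ , p₁ , init {Γ₁} ← focus d =
  ⟨ Γ₁ ++ Γ' ︔ _ ∷ Q ⟩ , ⇝*-trans p (⇝*-respˡ-≡s (≡s-lin q) (⇝*-split p₁ ⇝*-refl)) , here refl

-- T need not move: the reductions matching U ⇝₀ U' are performed inside the witness state.
≼ₚ-step : ∀ {U U' T} → U ≼ₚ T → U ⇝₀ U' → U' ≼ₚ T
≼ₚ-step (Γ' , _ , p , _∷_ {P} {Q} d ds , es) r⊗
  with _ , q , ⊗R {Γ₁} {P₁} {P₂} d₁ d₂ ← focus d =
  Γ₁ ++ Γ' , P₁ ++ (P₂ ++ Q) ,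
  ⇝*-respʳ-≡s (⇝*-trans p (⇝*-split q ⇝*-refl)) (≡s-lin (↭-reflexive (++-assoc P₁ P₂ Q))) ,
  ⊢-weaken (xs⊆xs++ys Γ₁ Γ') d₁ ∷ ⊢-weaken (xs⊆xs++ys Γ₁ Γ') d₂ ∷ ⊢*-weaken (xs⊆ys++xs Γ' Γ₁) ds ,
  ⊢!-weaken (xs⊆ys++xs Γ' Γ₁) es
≼ₚ-step (Γ' , _ , p , d ∷ ds , es) r𝟏 with _ , q , 𝟏R {Γ₁} ← focus d =
  Γ₁ ++ Γ' , _ , ⇝*-trans p (⇝*-split q ⇝*-refl) ,
  ⊢*-weaken (xs⊆ys++xs Γ' Γ₁) ds , ⊢!-weaken (xs⊆ys++xs Γ' Γ₁) es
≼ₚ-step (Γ' , _ , p , d ∷ ds , es) r&₁ = Γ' , _ , p , &R-inv₁ d ∷ ds , es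
≼ₚ-step (Γ' , _ , p , d ∷ ds , es) r&₂ = Γ' , _ , p , &R-inv₂ d ∷ ds , es
≼ₚ-step (Γ' , _ , p , _∷_ {P₁} d₁ (_∷_ {P₂} {Q} d₂ ds) , es) r⊸ =
  Γ' , (P₁ ++ P₂) ++ Q , ⇝*-respʳ-≡s p (≡s-lin (↭-reflexive (sym (++-assoc P₁ P₂ Q)))) ,
  ⊸-elim d₁ d₂ ∷ ds , es
≼ₚ-step (Γ' , _ , p , d ∷ ds , es) r! with _ , q , !R {Γ₁} d' ← focus d =
  Γ₁ ++ Γ' , _ , ⇝*-trans p (⇝*-split q ⇝*-refl) , ⊢*-weaken (xs⊆ys++xs Γ' Γ₁) ds ,
  ⊢!-∷ (⊢-weaken (xs⊆xs++ys Γ₁ Γ') d') (⊢!-weaken (xs⊆ys++xs Γ' Γ₁) es)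
≼ₚ-step (Γ' , P , p , ds , es) rclone = Γ' , P , p , es (here refl) ∷ ds , es

≼ₚ-reductionClosed : ReductionClosed _≼ₚ_
≼ₚ-reductionClosed {S₁} {S₂} r (U , U' , e , s , e') =
  S₂ , ⇝*-refl , ≼ₚ-respects e' ≡s-refl (≼ₚ-step (≼ₚ-respects e (≡s-refl {S₂}) r) s)

≼ₚ-compositional : Compositional _≼ₚ_
≼ₚ-compositional {S₁} (Γ' , P , p , ds , es) S =
  Γ' ++ pers S , P ++ lin S , ⇝*-∥ˡ p ,
  ⊢*-++ (⊢*-weaken (xs⊆xs++ys Γ' (pers S)) ds) (⊢*-id (lin S)) ,
  ⊢!-++ (pers S₁) (⊢!-weaken (xs⊆xs++ys Γ' (pers S)) es) (⊢-pers ∘ ∈-++⁺ʳ Γ')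

≼ₚ-partitionPreserving : PartitionPreserving _≼ₚ_
≼ₚ-partitionPreserving {Γ₁} {Δ₁} {Γ₂} {Δ₂} r = empty r , split
  where
  empty : ⟨ Γ₁ ︔ Δ₁ ⟩ ≼ₚ ⟨ Γ₂ ︔ Δ₂ ⟩ → Δ₁ ↭ [] →
    ∃[ Γ₂' ] (⟨ Γ₂ ︔ Δ₂ ⟩ ⇝* ⟨ Γ₂' ︔ [] ⟩) × ⟨ Γ₁ ︔ [] ⟩ ≼ₚ ⟨ Γ₂' ︔ [] ⟩
  empty r e with ↭.↭-empty-inv e
  empty (Γ' , _ , p , [] , es) e | refl = Γ' , p , Γ' , [] , ⇝*-refl , [] , es
  split : ∀ S₁ S₁' → ⟨ Γ₁ ︔ Δ₁ ⟩ ≡s (S₁ ∥ S₁') →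
    ∃[ S₂ ] ∃[ S₂' ] (⟨ Γ₂ ︔ Δ₂ ⟩ ⇝* (S₂ ∥ S₂')) × S₁ ≼ₚ S₂ × S₁' ≼ₚ S₂'
  split S₁ S₁' e
    with Γ' , _ , p , ds , es ← ≼ₚ-respects e (≡s-refl {⟨ Γ₂ ︔ Δ₂ ⟩}) r
    with P₁ , P₂ , refl , ds₁ , ds₂ ← ⊢*-split (lin S₁) ds =
    ⟨ Γ' ︔ P₁ ⟩ , ⟨ Γ' ︔ P₂ ⟩ , ⇝*-respʳ-≡s p (≡s-split P₁) ,
    (Γ' , P₁ , ⇝*-refl , ds₁ , es ∘ ∈-++⁺ˡ) , (Γ' , P₂ , ⇝*-refl , ds₂ , es ∘ ∈-++⁺ʳ (pers S₁))

≼ₚ-contextual : IsContextual _≼ₚ_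
≼ₚ-contextual = record
  { respects  = ≼ₚ-respects
  ; barb      = ≼ₚ-barb
  ; redClosed = ≼ₚ-reductionClosed
  ; compos    = ≼ₚ-compositional
  ; partition = ≼ₚ-partitionPreserving
  }

corollary2 : ∀ (Γ₁ Δ₁ Γ₂ Δ₂ : Ctx) →
    (⟨ Γ₁ ︔ Δ₁ ⟩ ≼l ⟨ Γ₂ ︔ Δ₂ ⟩) ⇔ (⟨ Γ₁ ︔ Δ₁ ⟩ ≼c ⟨ Γ₂ ︔ Δ₂ ⟩)
corollary2 Γ₁ Δ₁ Γ₂ Δ₂ = mk⇔ (λ h → _≼ₚ_ , ≼ₚ-contextual , ≼l⇒≼ₚ h) ≼c⇒≼l
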